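{- Let $t\ge1$, let $k_1,\ldots,k_t\ge 3$ be integers and $\kappa:=\sum_{i=1}^t(k_i-1)$. Then the complete bipartite graph $K_{\kappa+1,\kappa+t}$ contains $C_{2k_1,\ldots,2k_t}$ as a subgraph.
   Context: $C_{2k_1,\ldots,2k_t}$ is the graph obtained from cycles $C_{2k_1},\ldots,C_{2k_t}$ intersecting in exactly one common vertex (otherwise vertex-disjoint). -}

module Defs where

open import Data.Nat using (ℕ; zero; suc; _+_; _*_; _∸_)
open import Data.Fin using (Fin; toℕ)
import Data.Fin as F
open import Data.Product using (Σ; _,_)
open import Data.Sum using (_⊎_; inj₁; inj₂)
open import Data.Unit using (⊤)
open import Data.Empty using (⊥)
open import Relation.Binary.PropositionalEquality using (_≡_)
open import Function.Definitions using (Injective)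

record Graph : Set₁ where
  field
    V   : Set
    Adj : V → V → Set

open Graph public

sumF : (t : ℕ) → (Fin t → ℕ) → ℕ
sumF zero    f = 0
sumF (suc t) f = f F.zero + sumF t (λ i → f (F.suc i))

kappa : (t : ℕ) → (Fin t → ℕ) → ℕ
kappa t ks = sumF t (λ i → ks i ∸ 1)

KAdj : {a b : ℕ} → Fin a ⊎ Fin b → Fin a ⊎ Fin b → Set
KAdj (inj₁ _) (inj₁ _) = ⊥
KAdj (inj₁ _) (inj₂ _) = ⊤
KAdj (inj₂ _) (inj₁ _) = ⊤
KAdj (inj₂ _) (inj₂ _) = ⊥

K : ℕ → ℕ → Graph
K a b = record { V = Fin a ⊎ Fin b ; Adj = KAdj }

-- Vertices of C_{2k_1,...,2k_t}: the common vertex (hub), and for each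
-- cycle i its 2k_i - 1 remaining vertices, numbered 0 .. 2k_i - 2 along the cycle.
data CVert (t : ℕ) (ks : Fin t → ℕ) : Set where
  hub   : CVert t ks
  inner : (i : Fin t) → Fin (2 * ks i ∸ 1) → CVert t ks

data CAdj (t : ℕ) (ks : Fin t → ℕ) : CVert t ks → CVert t ks → Set where
  hub-first : (i : Fin t) (j : Fin (2 * ks i ∸ 1)) → toℕ j ≡ 0 →
              CAdj t ks hub (inner i j)
  hub-last  : (i : Fin t) (j : Fin (2 * ks i ∸ 1)) → toℕ j ≡ 2 * ks i ∸ 2 →
              CAdj t ks hub (inner i j)
  step      : (i : Fin t) (j j' : Fin (2 * ks i ∸ 1)) → toℕ j' ≡ suc (toℕ j) →
              CAdj t ks (inner i j) (inner i j')
  sym-adj   : {u v : CVert t ks} → CAdj t ks u v → CAdj t ks v u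

C : (t : ℕ) → (Fin t → ℕ) → Graph
C t ks = record { V = CVert t ks ; Adj = CAdj t ks }

_⊆G_ : Graph → Graph → Set
H ⊆G G = Σ (V H → V G) λ f →
           Σ (Injective _≡_ _≡_ f) λ _ →
             ∀ u v → Adj H u v → Adj G (f u) (f v)

{-# OPTIONS --safe #-}
module Submission where

-- C_{2k_1,...,2k_t} is bipartite: colour the hub and the odd positions of every
-- cycle on one side and the even positions on the other.  The first class has
-- 1 + Σ (k_i - 1) = κ + 1 vertices and the second Σ k_i ≤ κ + t, so laying out
-- each class cycle by cycle in consecutive blocks of the corresponding part of
-- K_{κ+1,κ+t} is an injective map sending edges to edges.

open import Defs
open import Data.Nat using (ℕ; zero; suc; _+_; _*_; _∸_; _≤_; ⌊_/2⌋; ⌈_/2⌉; parity)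
open import Data.Nat.Properties
  using (≤-refl; +-suc; +-identityʳ; +-assoc; +-cancelˡ-≡; +-mono-≤; m≤n+m∸n; *-distribˡ-∸;
         n≡⌊n+n/2⌋; ⌊n/2⌋+⌈n/2⌉≡n; module ≤-Reasoning)
open import Data.Parity.Base using (Parity; 0ℙ; 1ℙ)
open import Data.Parity.Properties using (p≢p⁻¹; suc-homo-⁻¹; *-homo-*)
open import Data.Fin.Base using (Fin; toℕ; _↑ˡ_; _↑ʳ_; splitAt; cast; inject≤)
import Data.Fin.Base as Fin
open import Data.Fin.Properties
  using (toℕ-injective; toℕ-cast; ↑ˡ-injective; ↑ʳ-injective; splitAt-↑ˡ; splitAt-↑ʳ;
         inject≤-injective)
open import Data.Product.Base using (Σ; _,_; proj₂)
open import Data.Product.Function.Dependent.Propositional using (Σ-↣)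
open import Data.Sum.Base using (_⊎_; inj₁; inj₂)
import Data.Sum.Base as Sum
open import Data.Sum.Properties using (inj₁-injective; inj₂-injective)
open import Data.Unit.Base using (tt)
open import Data.Empty using (⊥-elim)
open import Function.Base using (_∘_)
open import Function.Bundles using (Injection; mk↣)
open import Function.Construct.Identity using (↔-id)
open import Function.Definitions using (Injective)
open import Relation.Binary.PropositionalEquality
  using (_≡_; _≢_; refl; sym; trans; cong; subst₂; module ≡-Reasoning)

side : {A B : Set} → A ⊎ B → Parity
side (inj₁ _) = 1ℙ
side (inj₂ _) = 0ℙ

side-map : {A B C D : Set} {f : A → C} {g : B → D} (x : A ⊎ B) →
           side (Sum.map f g x) ≡ side x
side-map (inj₁ _) = refl
side-map (inj₂ _) = refl

splitParity : ∀ n → Fin n → Fin ⌊ n /2⌋ ⊎ Fin ⌈ n /2⌉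
splitParity (suc n)       Fin.zero              = inj₂ Fin.zero
splitParity (suc (suc n)) (Fin.suc Fin.zero)    = inj₁ Fin.zero
splitParity (suc (suc n)) (Fin.suc (Fin.suc j)) = Sum.map Fin.suc Fin.suc (splitParity n j)

side-splitParity : ∀ n (j : Fin n) → side (splitParity n j) ≡ parity (toℕ j)
side-splitParity (suc n)       Fin.zero              = refl
side-splitParity (suc (suc n)) (Fin.suc Fin.zero)    = refl
side-splitParity (suc (suc n)) (Fin.suc (Fin.suc j)) =
  trans (side-map (splitParity n j)) (side-splitParity n j)

interleave : ∀ {a b} → Fin a ⊎ Fin b → ℕ
interleave (inj₁ h) = suc (toℕ h + toℕ h)
interleave (inj₂ h) = toℕ h + toℕ h

interleave-map-suc : ∀ {a b} (x : Fin a ⊎ Fin b) →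
                     interleave (Sum.map Fin.suc Fin.suc x) ≡ 2 + interleave x
interleave-map-suc (inj₁ h) = cong (suc ∘ suc) (+-suc (toℕ h) (toℕ h))
interleave-map-suc (inj₂ h) = cong suc (+-suc (toℕ h) (toℕ h))

interleave-map-cast : ∀ {a a′ b b′} .(e : a ≡ a′) .(e′ : b ≡ b′) (x : Fin a ⊎ Fin b) →
                      interleave (Sum.map (cast e) (cast e′) x) ≡ interleave x
interleave-map-cast e e′ (inj₁ h) = cong (λ n → suc (n + n)) (toℕ-cast e h)
interleave-map-cast e e′ (inj₂ h) = cong (λ n → n + n) (toℕ-cast e′ h)

interleave-splitParity : ∀ n (j : Fin n) → interleave (splitParity n j) ≡ toℕ j
interleave-splitParity (suc n)       Fin.zero              = refl
interleave-splitParity (suc (suc n)) (Fin.suc Fin.zero)    = refl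
interleave-splitParity (suc (suc n)) (Fin.suc (Fin.suc j)) =
  trans (interleave-map-suc (splitParity n j)) (cong (2 +_) (interleave-splitParity n j))

2[1+k]∸1≡1+2k : ∀ k → 2 * suc k ∸ 1 ≡ suc (k + k)
2[1+k]∸1≡1+2k k = trans (+-suc k (k + 0)) (cong (suc ∘ (k +_)) (+-identityʳ k))

⌈n+n/2⌉≡n : ∀ n → ⌈ n + n /2⌉ ≡ n
⌈n+n/2⌉≡n n = +-cancelˡ-≡ n _ _ (begin
  n + ⌈ n + n /2⌉           ≡⟨ cong (_+ ⌈ n + n /2⌉) (n≡⌊n+n/2⌋ n) ⟩
  ⌊ n + n /2⌋ + ⌈ n + n /2⌉ ≡⟨ ⌊n/2⌋+⌈n/2⌉≡n (n + n) ⟩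
  n + n                     ∎)
  where open ≡-Reasoning

⌊2k∸1/2⌋≡k∸1 : ∀ k → ⌊ 2 * k ∸ 1 /2⌋ ≡ k ∸ 1
⌊2k∸1/2⌋≡k∸1 zero    = refl
⌊2k∸1/2⌋≡k∸1 (suc k) = trans (cong ⌊_/2⌋ (2[1+k]∸1≡1+2k k)) (⌈n+n/2⌉≡n k)

⌈2k∸1/2⌉≡k : ∀ k → ⌈ 2 * k ∸ 1 /2⌉ ≡ k
⌈2k∸1/2⌉≡k zero    = refl
⌈2k∸1/2⌉≡k (suc k) = trans (cong ⌈_/2⌉ (2[1+k]∸1≡1+2k k)) (cong suc (sym (n≡⌊n+n/2⌋ k)))

splitCycle : ∀ k → Fin (2 * k ∸ 1) → Fin (k ∸ 1) ⊎ Fin k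
splitCycle k = Sum.map (cast (⌊2k∸1/2⌋≡k∸1 k)) (cast (⌈2k∸1/2⌉≡k k)) ∘ splitParity (2 * k ∸ 1)

splitCycle-injective : ∀ k → Injective _≡_ _≡_ (splitCycle k)
splitCycle-injective k {i} {j} e = toℕ-injective (begin
  toℕ i                       ≡⟨ interleave-toℕ i ⟨
  interleave (splitCycle k i) ≡⟨ cong interleave e ⟩
  interleave (splitCycle k j) ≡⟨ interleave-toℕ j ⟩
  toℕ j                       ∎)
  where
  open ≡-Reasoning
  interleave-toℕ : ∀ j → interleave (splitCycle k j) ≡ toℕ j
  interleave-toℕ j = trans (interleave-map-cast _ _ (splitParity (2 * k ∸ 1) j))
                           (interleave-splitParity _ j)

side-splitCycle : ∀ k (j : Fin (2 * k ∸ 1)) → side (splitCycle k j) ≡ parity (toℕ j)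
side-splitCycle k j = trans (side-map (splitParity (2 * k ∸ 1) j)) (side-splitParity _ j)

↑ˡ≢↑ʳ : ∀ {m n} (i : Fin m) (j : Fin n) → i ↑ˡ n ≢ m ↑ʳ j
↑ˡ≢↑ʳ {m} {n} i j e
  with trans (sym (splitAt-↑ˡ m i n)) (trans (cong (splitAt m) e) (splitAt-↑ʳ m n j))
... | ()

pack : ∀ t (w : Fin t → ℕ) → Σ (Fin t) (Fin ∘ w) → Fin (sumF t w)
pack (suc t) w (Fin.zero  , h) = h ↑ˡ sumF t (w ∘ Fin.suc)
pack (suc t) w (Fin.suc i , h) = w Fin.zero ↑ʳ pack t (w ∘ Fin.suc) (i , h)

pack-injective : ∀ t w → Injective _≡_ _≡_ (pack t w)
pack-injective (suc t) w {Fin.zero  , h} {Fin.zero   , h′} e =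
  cong (Fin.zero ,_) (↑ˡ-injective _ h h′ e)
pack-injective (suc t) w {Fin.zero  , h} {Fin.suc i′ , h′} e = ⊥-elim (↑ˡ≢↑ʳ h _ e)
pack-injective (suc t) w {Fin.suc i , h} {Fin.zero   , h′} e = ⊥-elim (↑ˡ≢↑ʳ h′ _ (sym e))
pack-injective (suc t) w {Fin.suc i , h} {Fin.suc i′ , h′} e
  with pack-injective t (w ∘ Fin.suc) (↑ʳ-injective (w Fin.zero) _ _ e)
... | refl = refl

sumF≤kappa+t : ∀ t w → sumF t w ≤ kappa t w + t
sumF≤kappa+t zero    w = ≤-refl
sumF≤kappa+t (suc t) w = begin
  w₀ + sumF t w′                  ≤⟨ +-mono-≤ (m≤n+m∸n w₀ 1) (sumF≤kappa+t t w′) ⟩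
  suc (w₀ ∸ 1) + (kappa t w′ + t) ≡⟨ sym (trans (+-suc _ t) (cong suc (+-assoc (w₀ ∸ 1) _ t))) ⟩
  kappa (suc t) w + suc t         ∎
  where
  open ≤-Reasoning
  w₀ = w Fin.zero
  w′ = w ∘ Fin.suc

parity[2k∸2]≡0ℙ : ∀ k → parity (2 * k ∸ 2) ≡ 0ℙ
parity[2k∸2]≡0ℙ k = trans (cong parity (sym (*-distribˡ-∸ 2 k 1))) (*-homo-* 2 (k ∸ 1))

parity-suc≢ : ∀ n → parity (suc n) ≢ parity n
parity-suc≢ n e = p≢p⁻¹ (parity (suc n)) (trans e (sym (suc-homo-⁻¹ n)))

colour : ∀ {t ks} → CVert t ks → Parity
colour hub         = 1ℙ
colour (inner i j) = parity (toℕ j)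

colour-proper : ∀ {t ks} {u v : CVert t ks} → CAdj t ks u v → colour u ≢ colour v
colour-proper (hub-first i j j≡0) rewrite j≡0 = λ ()
colour-proper {ks = ks} (hub-last i j j≡last) rewrite j≡last | parity[2k∸2]≡0ℙ (ks i) = λ ()
colour-proper (step i j j′ j′≡1+j) rewrite j′≡1+j = parity-suc≢ (toℕ j) ∘ sym
colour-proper (sym-adj uv) = colour-proper uv ∘ sym

side≢⇒KAdj : ∀ {a b} (x y : Fin a ⊎ Fin b) → side x ≢ side y → KAdj x y
side≢⇒KAdj (inj₁ _) (inj₁ _) x≢y = ⊥-elim (x≢y refl)
side≢⇒KAdj (inj₁ _) (inj₂ _) _   = tt
side≢⇒KAdj (inj₂ _) (inj₁ _) _   = tt
side≢⇒KAdj (inj₂ _) (inj₂ _) x≢y = ⊥-elim (x≢y refl)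

module Embedding (t : ℕ) (ks : Fin t → ℕ) where

  κ : ℕ
  κ = kappa t ks

  Target : Set
  Target = Fin (κ + 1) ⊎ Fin (κ + t)

  place : Σ (Fin t) (λ i → Fin (ks i ∸ 1) ⊎ Fin (ks i)) → Target
  place (i , inj₁ h) = inj₁ (pack t (λ i → ks i ∸ 1) (i , h) ↑ˡ 1)
  place (i , inj₂ h) = inj₂ (inject≤ (pack t ks (i , h)) (sumF≤kappa+t t ks))

  embed : CVert t ks → Target
  embed hub         = inj₁ (κ ↑ʳ Fin.zero)
  embed (inner i j) = place (i , splitCycle (ks i) j)

  place-injective : Injective _≡_ _≡_ place
  place-injective {i , inj₁ h} {i′ , inj₁ h′} e
    with pack-injective t _ (↑ˡ-injective 1 _ _ (inj₁-injective e))
  ... | refl = refl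
  place-injective {i , inj₂ h} {i′ , inj₂ h′} e
    with pack-injective t ks (inject≤-injective _ _ _ _ (inj₂-injective e))
  ... | refl = refl

  place≢embed-hub : ∀ p → place p ≢ embed hub
  place≢embed-hub (i , inj₁ h) e = ↑ˡ≢↑ʳ _ _ (inj₁-injective e)

  embed-injective : Injective _≡_ _≡_ embed
  embed-injective {hub}       {hub}         _ = refl
  embed-injective {hub}       {inner i′ j′} e = ⊥-elim (place≢embed-hub _ (sym e))
  embed-injective {inner i j} {hub}         e = ⊥-elim (place≢embed-hub _ e)
  embed-injective {inner i j} {inner i′ j′} e
    with Injection.injective (Σ-↣ (↔-id _) (mk↣ (splitCycle-injective (ks _)))) (place-injective e)
  ... | refl = refl

  side-place : ∀ p → side (place p) ≡ side (proj₂ p)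
  side-place (i , inj₁ _) = refl
  side-place (i , inj₂ _) = refl

  side-embed : ∀ v → side (embed v) ≡ colour v
  side-embed hub         = refl
  side-embed (inner i j) = trans (side-place (i , splitCycle (ks i) j)) (side-splitCycle (ks i) j)

  embed-adj : ∀ {u v} → CAdj t ks u v → KAdj (embed u) (embed v)
  embed-adj {u} {v} uv = side≢⇒KAdj (embed u) (embed v)
    (subst₂ _≢_ (sym (side-embed u)) (sym (side-embed v)) (colour-proper uv))

lemma3p3 : (t : ℕ) → 1 ≤ t → (ks : Fin t → ℕ) → (∀ i → 3 ≤ ks i) →
           C t ks ⊆G K (kappa t ks + 1) (kappa t ks + t)
lemma3p3 t _ ks _ = embed , embed-injective , λ _ _ → embed-adj
  where open Embedding t ks
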